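{- (a) $\Gamma(K_{3,3})\cong\mathbb{Z}_2^4$, and if $b$ is an even parity $\mathbb{Z}_2$-colouring of $K_{3,3}$ then $\Gamma(K_{3,3},b)\cong\mathbb{Z}_2^5$. (b) $\Gamma(K_5)\cong\mathbb{Z}_2^6$, and if $b$ is an even parity $\mathbb{Z}_2$-colouring of $K_5$ then $\Gamma(K_5,b)\cong\mathbb{Z}_2^7$.
   Context: $K_{3,3}$ is the complete bipartite graph with parts of size 3; $K_5$ is the complete graph on 5 vertices. $E(v)$ is the set of edges at $v$. A $\mathbb{Z}_2$-colouring is any $b:V(G)\to\mathbb{Z}_2$, with parity $\sum_v b(v)$. $\Gamma(G,b)$ is generated by $\{x_e:e\in E(G)\}\cup\{J\}$ with relations $J^2=x_e^2=1$, $[x_e,J]=1$, $[x_e,x_{e'}]=1$ whenever $e,e'\in E(v)$ for some $v$, and $\prod_{e\in E(v)}x_e=J^{b(v)}$ for every vertex $v$. $\Gamma(G)$ is defined the same way with generators $x_e$ only and $J$ replaced by $1$ in all relations. -}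

module Defs where

open import Level using (0ℓ)
open import Data.Nat using (ℕ)
open import Data.Bool using (Bool; true; false; _xor_; if_then_else_)
open import Data.Fin using (Fin; _≟_)
open import Data.Fin.Patterns
open import Data.Product using (_×_; _,_; proj₁; proj₂; ∃-syntax)
open import Data.Sum using (_⊎_)
open import Data.List using (List; foldr; map; filter)
open import Data.List.Base using (allFin)
open import Data.Vec using (Vec; zipWith; replicate; lookup; _∷_; [])
open import Relation.Binary.PropositionalEquality using (_≡_)
open import Relation.Nullary.Decidable using (_⊎-dec_)
open import Algebra.Bundles.Raw using (RawGroup)
open import Algebra.Morphism.Structures using (module GroupMorphisms)

data Word (X : Set) : Set where
  gen  : X → Word X
  one  : Word X
  _·_  : Word X → Word X → Word X
  inv  : Word X → Word X

infixl 7 _·_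

data Cong {X : Set} (R : Word X → Word X → Set) : Word X → Word X → Set where
  rel     : ∀ {u v} → R u v → Cong R (u) (v)
  refl∼   : ∀ {u} → Cong R (u) (u)
  sym∼    : ∀ {u v} → Cong R (u) (v) → Cong R (v) (u)
  trans∼  : ∀ {u v w} → Cong R (u) (v) → Cong R (v) (w) → Cong R (u) (w)
  ·-cong  : ∀ {u u' v v'} → Cong R (u) (u') → Cong R (v) (v') → Cong R (u · v) (u' · v')
  inv-cong : ∀ {u v} → Cong R (u) (v) → Cong R (inv u) (inv v)
  assoc   : ∀ {u v w} → Cong R ((u · v) · w) (u · (v · w))
  idˡ     : ∀ {u} → Cong R (one · u) (u)
  idʳ     : ∀ {u} → Cong R (u · one) (u)
  invˡ    : ∀ {u} → Cong R (inv u · u) (one)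
  invʳ    : ∀ {u} → Cong R (u · inv u) (one)

Presented : (X : Set) → (Word X → Word X → Set) → RawGroup 0ℓ 0ℓ
Presented X R = record
  { Carrier = Word X
  ; _≈_     = Cong R
  ; _∙_     = _·_
  ; ε       = one
  ; _⁻¹     = inv
  }

Z2^ : ℕ → RawGroup 0ℓ 0ℓ
Z2^ n = record
  { Carrier = Vec Bool n
  ; _≈_     = _≡_
  ; _∙_     = zipWith _xor_
  ; ε       = replicate n false
  ; _⁻¹     = λ v → v
  }

_≅_ : RawGroup 0ℓ 0ℓ → RawGroup 0ℓ 0ℓ → Set
G ≅ H = ∃[ f ] GroupMorphisms.IsGroupIsomorphism G H f

record Graph : Set where
  field
    nV   : ℕ
    nE   : ℕ
    ends : Fin nE → Fin nV × Fin nV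

open Graph public

Incident : (G : Graph) → Fin (nE G) → Fin (nV G) → Set
Incident G e v = proj₁ (ends G e) ≡ v ⊎ proj₂ (ends G e) ≡ v

E : (G : Graph) → Fin (nV G) → List (Fin (nE G))
E G v = filter (λ e → (proj₁ (ends G e) ≟ v) ⊎-dec (proj₂ (ends G e) ≟ v)) (allFin (nE G))

Colouring : Graph → Set
Colouring G = Fin (nV G) → Bool

parity : (G : Graph) → Colouring G → Bool
parity G b = foldr _xor_ false (map b (allFin (nV G)))

EvenParity : (G : Graph) → Colouring G → Set
EvenParity G b = parity G b ≡ false

data GenJ (m : ℕ) : Set where
  x : Fin m → GenJ m
  J : GenJ m

prodJ : ∀ {m} → List (Fin m) → Word (GenJ m)
prodJ = foldr (λ e w → gen (x e) · w) one

data RelΓb (G : Graph) (b : Colouring G) : Word (GenJ (nE G)) → Word (GenJ (nE G)) → Set where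
  J²     : RelΓb G b (gen J · gen J) one
  x²     : ∀ e → RelΓb G b (gen (x e) · gen (x e)) one
  xJ     : ∀ e → RelΓb G b (gen (x e) · gen J) (gen J · gen (x e))
  xx     : ∀ e e' v → Incident G e v → Incident G e' v →
           RelΓb G b (gen (x e) · gen (x e')) (gen (x e') · gen (x e))
  vertex : ∀ v → RelΓb G b (prodJ (E G v)) (if b v then gen J else one)

Γb : (G : Graph) → Colouring G → RawGroup 0ℓ 0ℓ
Γb G b = Presented (GenJ (nE G)) (RelΓb G b)

prod : ∀ {m} → List (Fin m) → Word (Fin m)
prod = foldr (λ e w → gen e · w) one

data RelΓ (G : Graph) : Word (Fin (nE G)) → Word (Fin (nE G)) → Set where
  x²     : ∀ e → RelΓ G (gen e · gen e) one
  xx     : ∀ e e' v → Incident G e v → Incident G e' v →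
           RelΓ G (gen e · gen e') (gen e' · gen e)
  vertex : ∀ v → RelΓ G (prod (E G v)) one

Γ : Graph → RawGroup 0ℓ 0ℓ
Γ G = Presented (Fin (nE G)) (RelΓ G)

K33ends : Vec (Fin 6 × Fin 6) 9
K33ends = (0F , 3F) ∷ (0F , 4F) ∷ (0F , 5F) ∷
          (1F , 3F) ∷ (1F , 4F) ∷ (1F , 5F) ∷
          (2F , 3F) ∷ (2F , 4F) ∷ (2F , 5F) ∷ []

K33 : Graph
K33 = record { nV = 6 ; nE = 9 ; ends = lookup K33ends }

K5ends : Vec (Fin 5 × Fin 5) 10
K5ends = (0F , 1F) ∷ (0F , 2F) ∷ (0F , 3F) ∷ (0F , 4F) ∷
         (1F , 2F) ∷ (1F , 3F) ∷ (1F , 4F) ∷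
         (2F , 3F) ∷ (2F , 4F) ∷
         (3F , 4F) ∷ []

K5 : Graph
K5 = record { nV = 5 ; nE = 10 ; ends = lookup K5ends }

-- In Γ(G, b) every x_e is an involution and J is central, so each vertex relation expresses
-- one edge at that vertex as the product of the others times a power of J.  For K₃,₃ every
-- generator thereby becomes a product of J and the four edges between {0,1} and {3,4}; for K₅
-- of J and the six edges of the K₄ on {0,1,2,3}.  The only missing relations are commutations of
-- disjoint basis edges.  One comes from expanding a single edge through two different vertices
-- (x₂₂ in K₃,₃, x₃₄ in K₅), where the powers of J agree exactly because b has even parity; the
-- others follow from two commuting edges at a common vertex.  So Γ(G, b) is generated by
-- pairwise commuting involutions, and an explicit ℤ₂-valued flow on G, together with a
-- "charge" on edges whose boundary is b, gives a homomorphism onto ℤ₂ⁿ⁺¹ sending these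
-- generators to the unit vectors.  Γ(G) is the case J = 1.

module Submission where

open import Level using (0ℓ)
open import Algebra.Bundles using (Group)
open import Data.Bool using (Bool; true; false; _xor_; if_then_else_)
open import Data.Bool.Properties
  using (xor-assoc; xor-comm; xor-same; xor-identityˡ; xor-identityʳ; xor-∧-commutativeRing)
open import Data.Fin using (Fin; zero; suc)
open import Data.Fin.Patterns
open import Data.List using (List; []; _∷_; foldr; allFin)
import Data.List as List
open import Data.Maybe using (just; nothing)
open import Data.Nat using (ℕ; suc)
open import Data.Product using (_×_; _,_)
open import Data.Sum using (inj₁; inj₂)
open import Data.Vec using (Vec; []; _∷_; zipWith; replicate; map; tabulate; lookup)
open import Data.Vec.Properties
  using (map-id; map-∘; tabulate-∘; zipWith-assoc; zipWith-comm; zipWith-identityˡ; zipWith-identityʳ;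
         zipWith-inverseˡ; ∷-injectiveˡ; ∷-injectiveʳ)
open import Data.Vec.Relation.Unary.All using (All; []; _∷_; universal)
open import Data.Vec.Relation.Unary.AllPairs using (AllPairs; []; _∷_)
open import Function using (id; _∘_)
open import Relation.Binary.PropositionalEquality
  using (_≡_; refl; sym; trans; cong; cong₂; module ≡-Reasoning)
open import Tactic.MonoidSolver using (solve)
open import Tactic.RingSolver using (solve-∀)
open import Tactic.RingSolver.Core.AlmostCommutativeRing using (AlmostCommutativeRing; fromCommutativeRing)
open import Defs hiding (assoc)

infixl 6 _⊕_

_⊕_ : ∀ {n} → Vec Bool n → Vec Bool n → Vec Bool n
_⊕_ = zipWith _xor_

⊕-self : ∀ {n} (a : Vec Bool n) → a ⊕ a ≡ replicate n false
⊕-self a = trans (cong (_⊕ a) (sym (map-id a))) (zipWith-inverseˡ {⁻¹ = id} xor-same a)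

xor≡false⇒≡ : ∀ {p q} → p xor q ≡ false → p ≡ q
xor≡false⇒≡ {false} eq = sym eq
xor≡false⇒≡ {true} {true} _ = refl

BoolRing : AlmostCommutativeRing 0ℓ 0ℓ
BoolRing = fromCommutativeRing xor-∧-commutativeRing λ { false → just refl ; true → nothing }

unit : ∀ {n} → Fin n → Vec Bool n
unit zero    = true ∷ replicate _ false
unit (suc i) = false ∷ unit i

units : ∀ n → Vec (Vec Bool n) n
units n = tabulate unit

combination : ∀ {k n} → Vec (Vec Bool n) k → Vec Bool k → Vec Bool n
combination []       []      = replicate _ false
combination (v ∷ vs) (c ∷ a) = (if c then v else replicate _ false) ⊕ combination vs a

combination-false∷ : ∀ {k n} (f : Fin k → Vec Bool n) a →
  combination (tabulate (λ i → false ∷ f i)) a ≡ false ∷ combination (tabulate f) a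
combination-false∷ f []          = refl
combination-false∷ f (true ∷ a)  = cong ((false ∷ f zero) ⊕_) (combination-false∷ (f ∘ suc) a)
combination-false∷ f (false ∷ a) = cong (replicate _ false ⊕_) (combination-false∷ (f ∘ suc) a)

combination-units : ∀ {n} (a : Vec Bool n) → combination (units n) a ≡ a
combination-units []      = refl
combination-units (c ∷ a) = begin
  (if c then unit zero else replicate _ false) ⊕ combination (tabulate (λ i → false ∷ unit i)) a
    ≡⟨ cong (_ ⊕_) (combination-false∷ unit a) ⟩
  (if c then unit zero else replicate _ false) ⊕ (false ∷ combination (units _) a)
    ≡⟨ cong (λ a′ → (if c then unit zero else replicate _ false) ⊕ (false ∷ a′)) (combination-units a) ⟩
  (if c then unit zero else replicate _ false) ⊕ (false ∷ a)
    ≡⟨ head-unit c ⟩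
  c ∷ a ∎
  where
  open ≡-Reasoning
  head-unit : ∀ c → (if c then unit zero else replicate _ false) ⊕ (false ∷ a) ≡ c ∷ a
  head-unit true  = cong (true ∷_) (zipWith-identityˡ xor-identityˡ a)
  head-unit false = cong (false ∷_) (zipWith-identityˡ xor-identityˡ a)

-- Commuting involutions

module GroupLemmas {c ℓ} (H : Group c ℓ) where
  open Group H renaming (refl to ≈-refl; sym to ≈-sym; trans to ≈-trans)
  open import Algebra.Properties.Group H using (∙-cancelˡ; ∙-cancelʳ; inverseʳ-unique)
  open import Relation.Binary.Reasoning.Setoid setoid

  Involution : Carrier → Set ℓ
  Involution g = g ∙ g ≈ ε

  Commute : Carrier → Carrier → Set ℓ
  Commute g h = g ∙ h ≈ h ∙ g

  Central : Carrier → Set _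
  Central z = ∀ g → Commute z g

  commute-resp : ∀ {g g′ h h′} → g ≈ g′ → h ≈ h′ → Commute g h → Commute g′ h′
  commute-resp g≈g′ h≈h′ gh = ≈-trans (∙-cong (≈-sym g≈g′) (≈-sym h≈h′)) (≈-trans gh (∙-cong h≈h′ g≈g′))

  commute-∙ : ∀ {g a b} → Commute g a → Commute g b → Commute g (a ∙ b)
  commute-∙ {g} {a} {b} ga gb = begin
    g ∙ (a ∙ b)  ≈⟨ assoc g a b ⟨
    (g ∙ a) ∙ b  ≈⟨ ∙-congʳ ga ⟩
    (a ∙ g) ∙ b  ≈⟨ assoc a g b ⟩
    a ∙ (g ∙ b)  ≈⟨ ∙-congˡ gb ⟩
    a ∙ (b ∙ g)  ≈⟨ assoc a b g ⟨
    (a ∙ b) ∙ g  ∎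

  commute-⁻¹ : ∀ {g a} → Commute g a → Commute g (a ⁻¹)
  commute-⁻¹ {g} {a} ga = begin
    g ∙ a ⁻¹                ≈⟨ solve monoid ⟩
    ε ∙ (g ∙ a ⁻¹)          ≈⟨ ∙-congʳ (inverseˡ a) ⟨
    (a ⁻¹ ∙ a) ∙ (g ∙ a ⁻¹) ≈⟨ solve monoid ⟩
    a ⁻¹ ∙ ((a ∙ g) ∙ a ⁻¹) ≈⟨ ∙-congˡ (∙-congʳ ga) ⟨
    a ⁻¹ ∙ ((g ∙ a) ∙ a ⁻¹) ≈⟨ solve monoid ⟩
    a ⁻¹ ∙ (g ∙ (a ∙ a ⁻¹)) ≈⟨ ∙-congˡ (∙-congˡ (inverseʳ a)) ⟩
    a ⁻¹ ∙ (g ∙ ε)          ≈⟨ solve monoid ⟩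
    a ⁻¹ ∙ g                ∎

  swap⇒commute : ∀ {a b w} → a ∙ (b ∙ w) ≈ b ∙ (a ∙ w) → Commute a b
  swap⇒commute {a} {b} {w} eq = ∙-cancelʳ w _ _ (begin
    (a ∙ b) ∙ w  ≈⟨ assoc a b w ⟩
    a ∙ (b ∙ w)  ≈⟨ eq ⟩
    b ∙ (a ∙ w)  ≈⟨ assoc b a w ⟨
    (b ∙ a) ∙ w  ∎)

  involution-conjugate : ∀ {a u} → Involution a → Commute a u → a ∙ (u ∙ a) ≈ u
  involution-conjugate {a} {u} aa au = begin
    a ∙ (u ∙ a)  ≈⟨ ∙-congˡ au ⟨
    a ∙ (a ∙ u)  ≈⟨ assoc a a u ⟨
    (a ∙ a) ∙ u  ≈⟨ ∙-congʳ aa ⟩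
    ε ∙ u        ≈⟨ identityˡ u ⟩
    u            ∎

  conjugate⇒commute : ∀ {a u} → Involution a → u ≈ a ∙ (u ∙ a) → Commute a u
  conjugate⇒commute {a} {u} aa eq = begin
    a ∙ u              ≈⟨ ∙-congˡ eq ⟩
    a ∙ (a ∙ (u ∙ a))  ≈⟨ assoc a a (u ∙ a) ⟨
    (a ∙ a) ∙ (u ∙ a)  ≈⟨ ∙-congʳ aa ⟩
    ε ∙ (u ∙ a)        ≈⟨ identityˡ (u ∙ a) ⟩
    u ∙ a              ∎

  cross-commute : ∀ {a b c d} → Commute a c → Commute b d → Commute a d →
                  Commute (a ∙ b) (c ∙ d) → Commute b c
  cross-commute {a} {b} {c} {d} ac bd ad abcd = ∙-cancelʳ d _ _ (∙-cancelˡ a _ _ (begin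
    a ∙ ((b ∙ c) ∙ d)  ≈⟨ solve monoid ⟩
    (a ∙ b) ∙ (c ∙ d)  ≈⟨ abcd ⟩
    (c ∙ d) ∙ (a ∙ b)  ≈⟨ solve monoid ⟩
    c ∙ ((d ∙ a) ∙ b)  ≈⟨ ∙-congˡ (∙-congʳ ad) ⟨
    c ∙ ((a ∙ d) ∙ b)  ≈⟨ solve monoid ⟩
    c ∙ (a ∙ (d ∙ b))  ≈⟨ ∙-congˡ (∙-congˡ bd) ⟨
    c ∙ (a ∙ (b ∙ d))  ≈⟨ solve monoid ⟩
    (c ∙ a) ∙ (b ∙ d)  ≈⟨ ∙-congʳ ac ⟨
    (a ∙ c) ∙ (b ∙ d)  ≈⟨ solve monoid ⟩
    a ∙ ((c ∙ b) ∙ d)  ∎))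

  commute-conjugate : ∀ {z u v} → Involution z → Commute z u → Commute z v →
                      Commute (z ∙ u) (v ∙ z) → Commute u v
  commute-conjugate {z} {u} {v} zz zu zv h = begin
    u ∙ v              ≈⟨ involution-conjugate zz (commute-∙ zu zv) ⟨
    z ∙ ((u ∙ v) ∙ z)  ≈⟨ solve monoid ⟩
    (z ∙ u) ∙ (v ∙ z)  ≈⟨ h ⟩
    (v ∙ z) ∙ (z ∙ u)  ≈⟨ solve monoid ⟩
    v ∙ ((z ∙ z) ∙ u)  ≈⟨ ∙-congˡ (∙-congʳ zz) ⟩
    v ∙ (ε ∙ u)        ≈⟨ ∙-congˡ (identityˡ u) ⟩
    v ∙ u              ∎

  involution-shift : ∀ {a u v} → Involution a → a ∙ u ≈ v → u ≈ a ∙ v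
  involution-shift {a} {u} {v} aa eq = begin
    u            ≈⟨ identityˡ u ⟨
    ε ∙ u        ≈⟨ ∙-congʳ aa ⟨
    (a ∙ a) ∙ u  ≈⟨ assoc a a u ⟩
    a ∙ (a ∙ u)  ≈⟨ ∙-congˡ eq ⟩
    a ∙ v        ∎

  last-factor₃ : ∀ {a b c k} → Involution a → Involution b →
                 a ∙ (b ∙ (c ∙ ε)) ≈ k → c ≈ (b ∙ a) ∙ k
  last-factor₃ {a} {b} {c} {k} aa bb eq = begin
    c                ≈⟨ identityʳ c ⟨
    c ∙ ε            ≈⟨ involution-shift bb (involution-shift aa eq) ⟩
    b ∙ (a ∙ k)      ≈⟨ assoc b a k ⟨
    (b ∙ a) ∙ k      ∎

  last-factor₄ : ∀ {a b c d k} → Involution a → Involution b → Involution c →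
                 a ∙ (b ∙ (c ∙ (d ∙ ε))) ≈ k → d ≈ (c ∙ (b ∙ a)) ∙ k
  last-factor₄ {a} {b} {c} {d} {k} aa bb cc eq = begin
    d                ≈⟨ identityʳ d ⟨
    d ∙ ε            ≈⟨ involution-shift cc (involution-shift bb (involution-shift aa eq)) ⟩
    c ∙ (b ∙ (a ∙ k))  ≈⟨ solve monoid ⟩
    (c ∙ (b ∙ a)) ∙ k  ∎

  product : {A : Set} → (A → Carrier) → List A → Carrier
  product g = foldr (λ e w → g e ∙ w) ε

  infixr 8 _^_

  _^_ : Carrier → Bool → Carrier
  g ^ p = if p then g else ε

  ε^ : ∀ p → ε ^ p ≈ ε
  ε^ true  = ≈-refl
  ε^ false = ≈-refl

  ^-xor : ∀ {g} → Involution g → ∀ p q → g ^ (p xor q) ≈ g ^ p ∙ g ^ q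
  ^-xor gg true  true  = ≈-sym gg
  ^-xor gg true  false = ≈-sym (identityʳ _)
  ^-xor gg false q     = ≈-sym (identityˡ _)

  ^-commute : ∀ {g h} → Commute g h → ∀ p → Commute (g ^ p) h
  ^-commute gh true  = gh
  ^-commute gh false = ≈-trans (identityˡ _) (≈-sym (identityʳ _))

  monomial : ∀ {n} → Vec Carrier n → Vec Bool n → Carrier
  monomial []       []      = ε
  monomial (g ∷ gs) (p ∷ a) = g ^ p ∙ monomial gs a

  CommutingInvolutions : ∀ {n} → Vec Carrier n → Set _
  CommutingInvolutions gs = All Involution gs × AllPairs Commute gs

  central-involution-∷ : ∀ {z n} {gs : Vec Carrier n} → Involution z → Central z →
                         CommutingInvolutions gs → CommutingInvolutions (z ∷ gs)
  central-involution-∷ zz z-central (involutions , commutes) =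
    zz ∷ involutions , universal z-central _ ∷ commutes

  monomial-zero : ∀ {n} (gs : Vec Carrier n) → monomial gs (replicate n false) ≈ ε
  monomial-zero []       = ≈-refl
  monomial-zero (g ∷ gs) = ≈-trans (identityˡ _) (monomial-zero gs)

  monomial-unit : ∀ {n} (gs : Vec Carrier n) i → monomial gs (unit i) ≈ lookup gs i
  monomial-unit (g ∷ gs) zero    = ≈-trans (∙-congˡ (monomial-zero gs)) (identityʳ g)
  monomial-unit (g ∷ gs) (suc i) = ≈-trans (identityˡ _) (monomial-unit gs i)

  monomial-commute : ∀ {g n} {gs : Vec Carrier n} → All (Commute g) gs → ∀ a → Commute g (monomial gs a)
  monomial-commute []         []      = ≈-trans (identityʳ _) (≈-sym (identityˡ _))
  monomial-commute (gh ∷ ggs) (p ∷ a) =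
    commute-∙ (≈-sym (^-commute (≈-sym gh) p)) (monomial-commute ggs a)

  monomial-⊕ : ∀ {n} {gs : Vec Carrier n} → CommutingInvolutions gs →
               ∀ a b → monomial gs (a ⊕ b) ≈ monomial gs a ∙ monomial gs b
  monomial-⊕ {gs = []}     _                       []      []      = ≈-sym (identityˡ ε)
  monomial-⊕ {gs = g ∷ gs} (gg ∷ involutions , ggs ∷ commutes) (p ∷ a) (q ∷ b) = begin
    g ^ (p xor q) ∙ monomial gs (a ⊕ b)                     ≈⟨ ∙-cong (^-xor gg p q) (monomial-⊕ (involutions , commutes) a b) ⟩
    (g ^ p ∙ g ^ q) ∙ (monomial gs a ∙ monomial gs b)       ≈⟨ solve monoid ⟩
    g ^ p ∙ ((g ^ q ∙ monomial gs a) ∙ monomial gs b)       ≈⟨ ∙-congˡ (∙-congʳ (^-commute (monomial-commute ggs a) q)) ⟩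
    g ^ p ∙ ((monomial gs a ∙ g ^ q) ∙ monomial gs b)       ≈⟨ solve monoid ⟩
    (g ^ p ∙ monomial gs a) ∙ (g ^ q ∙ monomial gs b)       ∎

  monomial-∙ : ∀ {n} {gs : Vec Carrier n} → CommutingInvolutions gs → ∀ {u v} a b →
               u ≈ monomial gs a → v ≈ monomial gs b → u ∙ v ≈ monomial gs (a ⊕ b)
  monomial-∙ ci a b u≈ v≈ = ≈-trans (∙-cong u≈ v≈) (≈-sym (monomial-⊕ ci a b))

  monomial-⁻¹ : ∀ {n} {gs : Vec Carrier n} → CommutingInvolutions gs → ∀ a →
                monomial gs a ⁻¹ ≈ monomial gs a
  monomial-⁻¹ {gs = gs} ci a = ≈-sym (inverseʳ-unique _ _ (begin
    monomial gs a ∙ monomial gs a   ≈⟨ monomial-⊕ ci a a ⟨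
    monomial gs (a ⊕ a)             ≈⟨ reflexive (cong (monomial gs) (⊕-self a)) ⟩
    monomial gs (replicate _ false) ≈⟨ monomial-zero gs ⟩
    ε                               ∎))

  module NormalForms {m n} (x : Fin m → Carrier) {J} {gs : Vec Carrier n}
                     (J∷gs-commute : CommutingInvolutions (J ∷ gs))
                     (charge : Fin m → Bool) (ψ : Fin m → Vec Bool n) where

    coordinates : Fin m → Vec Bool (suc n)
    coordinates e = charge e ∷ ψ e

    NormalForm : Fin m → Set ℓ
    NormalForm e = x e ≈ monomial (J ∷ gs) (coordinates e)

    generator-normal : ∀ i → lookup gs i ≈ monomial (J ∷ gs) (unit (suc i))
    generator-normal i = ≈-sym (monomial-unit (J ∷ gs) (suc i))

    J^-normal : ∀ p → J ^ p ≈ monomial (J ∷ gs) (p ∷ replicate n false)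
    J^-normal p = ≈-sym (≈-trans (∙-congˡ (monomial-zero gs)) (identityʳ (J ^ p)))

    solved₂-normal : ∀ {u} e f p → u ≈ (x e ∙ x f) ∙ J ^ p → NormalForm e → NormalForm f →
                     u ≈ monomial (J ∷ gs) ((coordinates e ⊕ coordinates f) ⊕ (p ∷ replicate n false))
    solved₂-normal e f p u≈ e≈ f≈ = ≈-trans u≈
      (monomial-∙ J∷gs-commute (coordinates e ⊕ coordinates f) (p ∷ replicate n false)
        (monomial-∙ J∷gs-commute (coordinates e) (coordinates f) e≈ f≈) (J^-normal p))

    solved₃-normal : ∀ {u} e f g p → u ≈ (x e ∙ (x f ∙ x g)) ∙ J ^ p →
                     NormalForm e → NormalForm f → NormalForm g →
                     u ≈ monomial (J ∷ gs) ((coordinates e ⊕ (coordinates f ⊕ coordinates g)) ⊕ (p ∷ replicate n false))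
    solved₃-normal e f g p u≈ e≈ f≈ g≈ = ≈-trans u≈
      (monomial-∙ J∷gs-commute (coordinates e ⊕ (coordinates f ⊕ coordinates g)) (p ∷ replicate n false)
        (monomial-∙ J∷gs-commute (coordinates e) (coordinates f ⊕ coordinates g) e≈
          (monomial-∙ J∷gs-commute (coordinates f) (coordinates g) f≈ g≈)) (J^-normal p))

  module CentralInvolution {z} (zz : Involution z) (z-central : Central z) where

    ^-central : ∀ p → Central (z ^ p)
    ^-central p g = ^-commute (z-central g) p

    interchange : ∀ {u v} p q → (u ∙ z ^ p) ∙ (v ∙ z ^ q) ≈ (u ∙ v) ∙ z ^ (p xor q)
    interchange {u} {v} p q = begin
      (u ∙ z ^ p) ∙ (v ∙ z ^ q)  ≈⟨ solve monoid ⟩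
      u ∙ ((z ^ p ∙ v) ∙ z ^ q)  ≈⟨ ∙-congˡ (∙-congʳ (^-central p v)) ⟩
      u ∙ ((v ∙ z ^ p) ∙ z ^ q)  ≈⟨ solve monoid ⟩
      (u ∙ v) ∙ (z ^ p ∙ z ^ q)  ≈⟨ ∙-congˡ (^-xor zz p q) ⟨
      (u ∙ v) ∙ z ^ (p xor q)    ∎

    absorb : ∀ {u} p q → (u ∙ z ^ p) ∙ z ^ q ≈ u ∙ z ^ (p xor q)
    absorb {u} p q = ≈-trans (assoc u _ _) (∙-congˡ (≈-sym (^-xor zz p q)))

    commute-modulo : ∀ {u v p q} → Commute (u ∙ z ^ p) (v ∙ z ^ q) → Commute u v
    commute-modulo {u} {v} {p} {q} h = ∙-cancelʳ (z ^ (p xor q)) _ _ (begin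
      (u ∙ v) ∙ z ^ (p xor q)    ≈⟨ interchange p q ⟨
      (u ∙ z ^ p) ∙ (v ∙ z ^ q)  ≈⟨ h ⟩
      (v ∙ z ^ q) ∙ (u ∙ z ^ p)  ≈⟨ interchange q p ⟩
      (v ∙ u) ∙ z ^ (q xor p)    ≡⟨ cong (λ r → (v ∙ u) ∙ z ^ r) (xor-comm q p) ⟩
      (v ∙ u) ∙ z ^ (p xor q)    ∎)

-- Presented groups onto ℤ₂ⁿ

presentedGroup : ∀ {X : Set} → (Word X → Word X → Set) → Group 0ℓ 0ℓ
presentedGroup {X} R = record
  { Carrier = Word X
  ; _≈_     = Cong R
  ; _∙_     = _·_
  ; ε       = one
  ; _⁻¹     = inv
  ; isGroup = record
    { isMonoid = record
      { isSemigroup = record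
        { isMagma = record
          { isEquivalence = record { refl = refl∼ ; sym = sym∼ ; trans = trans∼ }
          ; ∙-cong        = ·-cong
          }
        ; assoc = λ _ _ _ → Cong.assoc
        }
      ; identity = (λ _ → idˡ) , (λ _ → idʳ)
      }
    ; inverse = (λ _ → invˡ) , (λ _ → invʳ)
    ; ⁻¹-cong = inv-cong
    }
  }

evaluate : ∀ {X : Set} {n} → (X → Vec Bool n) → Word X → Vec Bool n
evaluate φ (gen y) = φ y
evaluate φ one     = replicate _ false
evaluate φ (u · v) = evaluate φ u ⊕ evaluate φ v
evaluate φ (inv u) = evaluate φ u

module _ {X : Set} (R : Word X → Word X → Set) {n} (φ : X → Vec Bool n)
         (φ-resp : ∀ {u v} → R u v → evaluate φ u ≡ evaluate φ v) where

  evaluate-cong : ∀ {u v} → Cong R u v → evaluate φ u ≡ evaluate φ v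
  evaluate-cong (rel r)       = φ-resp r
  evaluate-cong refl∼         = refl
  evaluate-cong (sym∼ p)      = sym (evaluate-cong p)
  evaluate-cong (trans∼ p q)  = trans (evaluate-cong p) (evaluate-cong q)
  evaluate-cong (·-cong p q)  = cong₂ _⊕_ (evaluate-cong p) (evaluate-cong q)
  evaluate-cong (inv-cong p)  = evaluate-cong p
  evaluate-cong (Cong.assoc {u} {v} {w}) = zipWith-assoc xor-assoc (evaluate φ u) (evaluate φ v) (evaluate φ w)
  evaluate-cong (idˡ {u})     = zipWith-identityˡ xor-identityˡ (evaluate φ u)
  evaluate-cong (idʳ {u})     = zipWith-identityʳ xor-identityʳ (evaluate φ u)
  evaluate-cong (invˡ {u})    = ⊕-self (evaluate φ u)
  evaluate-cong (invʳ {u})    = ⊕-self (evaluate φ u)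

  open Group (presentedGroup R) using (reflexive)
  open GroupLemmas (presentedGroup R)

  evaluate-monomial : ∀ {k} (gs : Vec (Word X) k) a →
                      evaluate φ (monomial gs a) ≡ combination (map (evaluate φ) gs) a
  evaluate-monomial []       []          = refl
  evaluate-monomial (g ∷ gs) (true ∷ a)  = cong (evaluate φ g ⊕_) (evaluate-monomial gs a)
  evaluate-monomial (g ∷ gs) (false ∷ a) = cong (replicate _ false ⊕_) (evaluate-monomial gs a)

  presented≅Z2^ : (gs : Vec (Word X) n) → CommutingInvolutions gs →
                  (∀ y → Cong R (gen y) (monomial gs (φ y))) →
                  map (evaluate φ) gs ≡ units n → Presented X R ≅ Z2^ n
  presented≅Z2^ gs ci gen-normal units-coordinates = evaluate φ , record
    { isGroupMonomorphism = record
      { isGroupHomomorphism = record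
        { isMonoidHomomorphism = record
          { isMagmaHomomorphism = record
            { isRelHomomorphism = record { cong = evaluate-cong }
            ; homo = λ _ _ → refl }
          ; ε-homo = refl }
        ; ⁻¹-homo = λ _ → refl }
      ; injective = λ {u} {v} eq → trans∼ (normal-form u)
          (trans∼ (reflexive (cong (monomial gs) eq)) (sym∼ (normal-form v))) }
    ; surjective = λ a → monomial gs a , λ u≈ → trans (evaluate-cong u≈) (evaluate-section a) }
    where
    normal-form : ∀ u → Cong R u (monomial gs (evaluate φ u))
    normal-form (gen y) = gen-normal y
    normal-form one     = sym∼ (monomial-zero gs)
    normal-form (u · v) = monomial-∙ ci _ _ (normal-form u) (normal-form v)
    normal-form (inv u) = trans∼ (inv-cong (normal-form u)) (monomial-⁻¹ ci (evaluate φ u))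

    evaluate-section : ∀ a → evaluate φ (monomial gs a) ≡ a
    evaluate-section a = trans (evaluate-monomial gs a)
      (trans (cong (λ vs → combination vs a) units-coordinates) (combination-units a))

⊕-sum : ∀ {A : Set} {n} → (A → Vec Bool n) → List A → Vec Bool n
⊕-sum f = foldr (λ e s → f e ⊕ s) (replicate _ false)

xor-sum : ∀ {A : Set} → (A → Bool) → List A → Bool
xor-sum c = foldr (λ e s → c e xor s) false

⊕-sum-∷ : ∀ {A : Set} {n} (c : A → Bool) (ψ : A → Vec Bool n) L →
          ⊕-sum (λ e → c e ∷ ψ e) L ≡ xor-sum c L ∷ ⊕-sum ψ L
⊕-sum-∷ c ψ []      = refl
⊕-sum-∷ c ψ (e ∷ L) = cong ((c e ∷ ψ e) ⊕_) (⊕-sum-∷ c ψ L)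

IsFlow : ∀ {n} (G : Graph) → (Fin (nE G) → Vec Bool n) → Set
IsFlow G ψ = ∀ v → ⊕-sum ψ (E G v) ≡ replicate _ false

HasBoundary : (G : Graph) → (Fin (nE G) → Bool) → Colouring G → Set
HasBoundary G c b = ∀ v → xor-sum c (E G v) ≡ b v

evaluate-prod : ∀ {m n} (φ : Fin m → Vec Bool n) L → evaluate φ (prod L) ≡ ⊕-sum φ L
evaluate-prod φ []      = refl
evaluate-prod φ (e ∷ L) = cong (φ e ⊕_) (evaluate-prod φ L)

evaluate-prodJ : ∀ {m n} (φ : GenJ m → Vec Bool n) L → evaluate φ (prodJ L) ≡ ⊕-sum (φ ∘ x) L
evaluate-prodJ φ []      = refl
evaluate-prodJ φ (e ∷ L) = cong (φ (x e) ⊕_) (evaluate-prodJ φ L)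

zero-colouring-even : ∀ G → EvenParity G (λ _ → false)
zero-colouring-even G = go (allFin (nV G))
  where
  go : ∀ vs → foldr _xor_ false (List.map (λ _ → false) vs) ≡ false
  go []       = refl
  go (_ ∷ vs) = go vs

module _ (G : Graph) (b : Colouring G) (H : Group 0ℓ 0ℓ) where
  open Group H
  open GroupLemmas H

  record GraphRelations (x : Fin (nE G) → Carrier) (J : Carrier) : Set where
    field
      J-involution : Involution J
      J-central    : Central J
      x-involution : ∀ e → Involution (x e)
      x-commute    : ∀ {e e′ v} → Incident G e v → Incident G e′ v → Commute (x e) (x e′)
      x-vertex     : ∀ v → product x (E G v) ≈ J ^ b v

Γb-relations : ∀ G b → GraphRelations G b (presentedGroup (RelΓb G b)) (gen ∘ x) (gen J)
Γb-relations G b = record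
  { J-involution = rel J²
  ; J-central    = J-central
  ; x-involution = λ e → rel (x² e)
  ; x-commute    = λ i i′ → rel (xx _ _ _ i i′)
  ; x-vertex     = λ v → rel (vertex v)
  }
  where
  open GroupLemmas (presentedGroup (RelΓb G b))
  J-central : Central (gen J)
  J-central (gen (x e)) = sym∼ (rel (xJ e))
  J-central (gen J)     = refl∼
  J-central one         = trans∼ idʳ (sym∼ idˡ)
  J-central (u · v)     = commute-∙ (J-central u) (J-central v)
  J-central (inv u)     = commute-⁻¹ (J-central u)

Γ-relations : ∀ G → GraphRelations G (λ _ → false) (presentedGroup (RelΓ G)) gen one
Γ-relations G = record
  { J-involution = idˡ
  ; J-central    = λ _ → trans∼ idˡ (sym∼ idʳ)
  ; x-involution = λ e → rel (x² e)
  ; x-commute    = λ i i′ → rel (xx _ _ _ i i′)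
  ; x-vertex     = λ v → rel (vertex v)
  }

pattern incident₁ = inj₁ refl
pattern incident₂ = inj₂ refl

-- The group-theoretic fields quantify over every group satisfying the relations of Γ(G, b),
-- so that one proof serves both Γ(G, b) and Γ(G) (the latter with J = ε and b = 0).
record Coordinates (G : Graph) (n : ℕ) : Set₁ where
  field
    ψ               : Fin (nE G) → Vec Bool n
    ψ-flow          : IsFlow G ψ
    basis           : Vec (Fin (nE G)) n
    ψ-basis         : map ψ basis ≡ units n
    charge          : Colouring G → Fin (nE G) → Bool
    charge-basis    : ∀ b → map (charge b) basis ≡ replicate n false
    charge-boundary : ∀ b → EvenParity G b → HasBoundary G (charge b) b
    basis-commute   : ∀ {b} → EvenParity G b → ∀ {H x J} → GraphRelations G b H x J →
                      GroupLemmas.CommutingInvolutions H (map x basis)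
    normal-form     : ∀ {b} → EvenParity G b → ∀ {H x J} → GraphRelations G b H x J → ∀ e →
                      let open Group H; open GroupLemmas H in
                      x e ≈ J ^ charge b e ∙ monomial (map x basis) (ψ e)

map-∷ : ∀ {A : Set} {k n} (c : A → Bool) (ψ : A → Vec Bool n) (es : Vec A k) →
        map c es ≡ replicate k false → map (λ e → c e ∷ ψ e) es ≡ map (false ∷_) (map ψ es)
map-∷ c ψ []       _  = refl
map-∷ c ψ (e ∷ es) eq =
  cong₂ _∷_ (cong (_∷ ψ e) (∷-injectiveˡ eq)) (map-∷ c ψ es (∷-injectiveʳ eq))

module _ {G : Graph} {n : ℕ} (C : Coordinates G n) where
  open Coordinates C

  Γ≅Z2^ : Γ G ≅ Z2^ n
  Γ≅Z2^ = presented≅Z2^ (RelΓ G) ψ ψ-resp (map gen basis)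
    (basis-commute (zero-colouring-even G) (Γ-relations G)) gen-normal
    (trans (sym (map-∘ (evaluate ψ) gen basis)) ψ-basis)
    where
    open GroupLemmas (presentedGroup (RelΓ G))
    ψ-resp : ∀ {u v} → RelΓ G u v → evaluate ψ u ≡ evaluate ψ v
    ψ-resp (x² e)         = ⊕-self (ψ e)
    ψ-resp (xx e e′ _ _ _) = zipWith-comm xor-comm (ψ e) (ψ e′)
    ψ-resp (vertex v)     = trans (evaluate-prod ψ (E G v)) (ψ-flow v)
    gen-normal : ∀ e → Cong (RelΓ G) (gen e) (monomial (map gen basis) (ψ e))
    gen-normal e = trans∼ (normal-form (zero-colouring-even G) (Γ-relations G) e)
                          (trans∼ (·-cong (ε^ (charge _ e)) refl∼) idˡ)

  Γb≅Z2^ : ∀ b → EvenParity G b → Γb G b ≅ Z2^ (suc n)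
  Γb≅Z2^ b even = presented≅Z2^ (RelΓb G b) φ φ-resp (gen J ∷ map (gen ∘ x) basis)
    (central-involution-∷ J-involution J-central (basis-commute even (Γb-relations G b)))
    gen-normal units-coordinates
    where
    open GroupLemmas (presentedGroup (RelΓb G b))
    open GraphRelations (Γb-relations G b)
    φ : GenJ (nE G) → Vec Bool (suc n)
    φ (x e) = charge b e ∷ ψ e
    φ J     = unit 0F
    evaluate-J^ : ∀ p → evaluate φ (gen J ^ p) ≡ p ∷ replicate n false
    evaluate-J^ true  = refl
    evaluate-J^ false = refl
    φ-resp : ∀ {u v} → RelΓb G b u v → evaluate φ u ≡ evaluate φ v
    φ-resp J²              = ⊕-self (φ J)
    φ-resp (x² e)          = ⊕-self (φ (x e))
    φ-resp (xJ e)          = zipWith-comm xor-comm (φ (x e)) (φ J)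
    φ-resp (xx e e′ _ _ _)  = zipWith-comm xor-comm (φ (x e)) (φ (x e′))
    φ-resp (vertex v)      = begin
      evaluate φ (prodJ (E G v))                       ≡⟨ evaluate-prodJ φ (E G v) ⟩
      ⊕-sum (φ ∘ x) (E G v)                            ≡⟨ ⊕-sum-∷ (charge b) ψ (E G v) ⟩
      xor-sum (charge b) (E G v) ∷ ⊕-sum ψ (E G v)     ≡⟨ cong₂ _∷_ (charge-boundary b even v) (ψ-flow v) ⟩
      b v ∷ replicate n false                          ≡⟨ evaluate-J^ (b v) ⟨
      evaluate φ (gen J ^ b v)                         ∎
      where open ≡-Reasoning
    gen-normal : ∀ y → Cong (RelΓb G b) (gen y) (monomial (gen J ∷ map (gen ∘ x) basis) (φ y))
    gen-normal (x e) = normal-form even (Γb-relations G b) e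
    gen-normal J     = sym∼ (monomial-unit (gen J ∷ map (gen ∘ x) basis) 0F)
    units-coordinates : map (evaluate φ) (gen J ∷ map (gen ∘ x) basis) ≡ units (suc n)
    units-coordinates = cong (unit 0F ∷_) (begin
      map (evaluate φ) (map (gen ∘ x) basis)   ≡⟨ map-∘ (evaluate φ) (gen ∘ x) basis ⟨
      map (λ e → charge b e ∷ ψ e) basis      ≡⟨ map-∷ (charge b) ψ basis (charge-basis b) ⟩
      map (false ∷_) (map ψ basis)            ≡⟨ cong (map (false ∷_)) ψ-basis ⟩
      map (false ∷_) (tabulate unit)          ≡⟨ tabulate-∘ (false ∷_) unit ⟨
      tabulate (λ i → false ∷ unit i)         ∎)
      where open ≡-Reasoning

-- K₃,₃

-- Coordinates of x_e read off from the solved vertex relations row₀, row₁, row₂, column₀ and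
-- column₁ below: ψ over the basis edges 0, 1, 3, 4, and the charge as the power of J.
K33-ψ : Fin 9 → Vec Bool 4
K33-ψ 0F = unit 0F
K33-ψ 1F = unit 1F
K33-ψ 2F = unit 1F ⊕ unit 0F
K33-ψ 3F = unit 2F
K33-ψ 4F = unit 3F
K33-ψ 5F = unit 3F ⊕ unit 2F
K33-ψ 6F = unit 2F ⊕ unit 0F
K33-ψ 7F = unit 3F ⊕ unit 1F
K33-ψ 8F = (unit 3F ⊕ unit 1F) ⊕ (unit 2F ⊕ unit 0F)

K33-charge : Colouring K33 → Fin 9 → Bool
K33-charge b 2F = b 0F
K33-charge b 5F = b 1F
K33-charge b 6F = b 3F
K33-charge b 7F = b 4F
K33-charge b 8F = (b 4F xor b 3F) xor b 2F
K33-charge b _  = false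

K33-ψ-flow : IsFlow K33 K33-ψ
K33-ψ-flow 0F = refl
K33-ψ-flow 1F = refl
K33-ψ-flow 2F = refl
K33-ψ-flow 3F = refl
K33-ψ-flow 4F = refl
K33-ψ-flow 5F = refl

K33-charge-boundary : ∀ b → EvenParity K33 b → HasBoundary K33 (K33-charge b) b
K33-charge-boundary b _    0F = xor-identityʳ (b 0F)
K33-charge-boundary b _    1F = xor-identityʳ (b 1F)
K33-charge-boundary b _    2F = cancel (b 2F) (b 3F) (b 4F)
  where
  cancel : ∀ b₂ b₃ b₄ → b₃ xor (b₄ xor (((b₄ xor b₃) xor b₂) xor false)) ≡ b₂
  cancel = solve-∀ BoolRing
K33-charge-boundary b _    3F = xor-identityʳ (b 3F)
K33-charge-boundary b _    4F = xor-identityʳ (b 4F)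
K33-charge-boundary b even 5F = xor≡false⇒≡ (trans (parity-sum (b 0F) (b 1F) (b 2F) (b 3F) (b 4F) (b 5F)) even)
  where
  parity-sum : ∀ b₀ b₁ b₂ b₃ b₄ b₅ →
    (b₀ xor (b₁ xor (((b₄ xor b₃) xor b₂) xor false))) xor b₅ ≡
    b₀ xor (b₁ xor (b₂ xor (b₃ xor (b₄ xor (b₅ xor false)))))
  parity-sum = solve-∀ BoolRing

K33-row≡column-exponent : ∀ b → EvenParity K33 b → (b 1F xor b 0F) xor b 5F ≡ (b 4F xor b 3F) xor b 2F
K33-row≡column-exponent b even = xor≡false⇒≡ (trans (parity-sum (b 0F) (b 1F) (b 2F) (b 3F) (b 4F) (b 5F)) even)
  where
  parity-sum : ∀ b₀ b₁ b₂ b₃ b₄ b₅ →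
    ((b₁ xor b₀) xor b₅) xor ((b₄ xor b₃) xor b₂) ≡
    b₀ xor (b₁ xor (b₂ xor (b₃ xor (b₄ xor (b₅ xor false)))))
  parity-sum = solve-∀ BoolRing

module K33-relations {b : Colouring K33} (even : EvenParity K33 b)
                     {H : Group 0ℓ 0ℓ} {x : Fin 9 → Group.Carrier H} {J : Group.Carrier H}
                     (relations : GraphRelations K33 b H x J) where
  open Group H renaming (refl to ≈-refl; sym to ≈-sym; trans to ≈-trans)
  open import Algebra.Properties.Group H using (∙-cancelˡ; ∙-cancelʳ)
  open GroupLemmas H
  open GraphRelations relations
  open CentralInvolution J-involution J-central
  open import Relation.Binary.Reasoning.Setoid setoid

  x₀₀ x₀₁ x₀₂ x₁₀ x₁₁ x₁₂ x₂₀ x₂₁ x₂₂ : Carrier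
  x₀₀ = x 0F
  x₀₁ = x 1F
  x₀₂ = x 2F
  x₁₀ = x 3F
  x₁₁ = x 4F
  x₁₂ = x 5F
  x₂₀ = x 6F
  x₂₁ = x 7F
  x₂₂ = x 8F

  row₀ : x₀₂ ≈ (x₀₁ ∙ x₀₀) ∙ J ^ b 0F
  row₀ = last-factor₃ (x-involution 0F) (x-involution 1F) (x-vertex 0F)

  row₁ : x₁₂ ≈ (x₁₁ ∙ x₁₀) ∙ J ^ b 1F
  row₁ = last-factor₃ (x-involution 3F) (x-involution 4F) (x-vertex 1F)

  row₂ : x₂₂ ≈ (x₂₁ ∙ x₂₀) ∙ J ^ b 2F
  row₂ = last-factor₃ (x-involution 6F) (x-involution 7F) (x-vertex 2F)

  column₀ : x₂₀ ≈ (x₁₀ ∙ x₀₀) ∙ J ^ b 3F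
  column₀ = last-factor₃ (x-involution 0F) (x-involution 3F) (x-vertex 3F)

  column₁ : x₂₁ ≈ (x₁₁ ∙ x₀₁) ∙ J ^ b 4F
  column₁ = last-factor₃ (x-involution 1F) (x-involution 4F) (x-vertex 4F)

  column₂ : x₂₂ ≈ (x₁₂ ∙ x₀₂) ∙ J ^ b 5F
  column₂ = last-factor₃ (x-involution 2F) (x-involution 5F) (x-vertex 5F)

  -- x₂₂ expanded along its row and along its column; the J-powers agree by even parity.
  x₂₂-row≈column : (x₁₁ ∙ x₀₁) ∙ (x₁₀ ∙ x₀₀) ≈ (x₁₁ ∙ x₁₀) ∙ (x₀₁ ∙ x₀₀)
  x₂₂-row≈column = ∙-cancelʳ (J ^ ((b 4F xor b 3F) xor b 2F)) _ _ (begin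
    ((x₁₁ ∙ x₀₁) ∙ (x₁₀ ∙ x₀₀)) ∙ J ^ ((b 4F xor b 3F) xor b 2F)   ≈⟨ absorb _ (b 2F) ⟨
    (((x₁₁ ∙ x₀₁) ∙ (x₁₀ ∙ x₀₀)) ∙ J ^ (b 4F xor b 3F)) ∙ J ^ b 2F  ≈⟨ ∙-congʳ (interchange (b 4F) (b 3F)) ⟨
    (((x₁₁ ∙ x₀₁) ∙ J ^ b 4F) ∙ ((x₁₀ ∙ x₀₀) ∙ J ^ b 3F)) ∙ J ^ b 2F  ≈⟨ ∙-congʳ (∙-cong column₁ column₀) ⟨
    (x₂₁ ∙ x₂₀) ∙ J ^ b 2F                                          ≈⟨ row₂ ⟨
    x₂₂                                                              ≈⟨ column₂ ⟩
    (x₁₂ ∙ x₀₂) ∙ J ^ b 5F                                          ≈⟨ ∙-congʳ (∙-cong row₁ row₀) ⟩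
    (((x₁₁ ∙ x₁₀) ∙ J ^ b 1F) ∙ ((x₀₁ ∙ x₀₀) ∙ J ^ b 0F)) ∙ J ^ b 5F  ≈⟨ ∙-congʳ (interchange (b 1F) (b 0F)) ⟩
    (((x₁₁ ∙ x₁₀) ∙ (x₀₁ ∙ x₀₀)) ∙ J ^ (b 1F xor b 0F)) ∙ J ^ b 5F  ≈⟨ absorb _ (b 5F) ⟩
    ((x₁₁ ∙ x₁₀) ∙ (x₀₁ ∙ x₀₀)) ∙ J ^ ((b 1F xor b 0F) xor b 5F)   ≡⟨ cong (λ p → (x₁₁ ∙ x₁₀) ∙ (x₀₁ ∙ x₀₀) ∙ J ^ p) exponents ⟩
    ((x₁₁ ∙ x₁₀) ∙ (x₀₁ ∙ x₀₀)) ∙ J ^ ((b 4F xor b 3F) xor b 2F)   ∎)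
    where exponents = K33-row≡column-exponent b even

  x₀₁x₁₀-commute : Commute x₀₁ x₁₀
  x₀₁x₁₀-commute = swap⇒commute (∙-cancelˡ x₁₁ _ _ (begin
    x₁₁ ∙ (x₀₁ ∙ (x₁₀ ∙ x₀₀))  ≈⟨ assoc x₁₁ x₀₁ _ ⟨
    (x₁₁ ∙ x₀₁) ∙ (x₁₀ ∙ x₀₀)  ≈⟨ x₂₂-row≈column ⟩
    (x₁₁ ∙ x₁₀) ∙ (x₀₁ ∙ x₀₀)  ≈⟨ assoc x₁₁ x₁₀ _ ⟩
    x₁₁ ∙ (x₁₀ ∙ (x₀₁ ∙ x₀₀))  ∎))

  x₀₀x₁₁-commute : Commute x₀₀ x₁₁
  x₀₀x₁₁-commute = cross-commute (x-commute incident₁ incident₁) (x-commute incident₁ incident₁)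
    (≈-sym x₀₁x₁₀-commute) (commute-modulo (commute-resp column₀ column₁ (x-commute incident₁ incident₁)))

  basis : Vec Carrier 4
  basis = x₀₀ ∷ x₀₁ ∷ x₁₀ ∷ x₁₁ ∷ []

  basis-commute : CommutingInvolutions basis
  basis-commute =
    x-involution 0F ∷ x-involution 1F ∷ x-involution 3F ∷ x-involution 4F ∷ [] ,
    (x-commute incident₁ incident₁ ∷ x-commute incident₂ incident₂ ∷ x₀₀x₁₁-commute ∷ []) ∷
    (x₀₁x₁₀-commute ∷ x-commute incident₂ incident₂ ∷ []) ∷
    (x-commute incident₁ incident₁ ∷ []) ∷
    [] ∷ []

  J∷basis-commute : CommutingInvolutions (J ∷ basis)
  J∷basis-commute = central-involution-∷ J-involution J-central basis-commute

  open NormalForms x J∷basis-commute (K33-charge b) K33-ψ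

  x₂₀-normal : NormalForm 6F
  x₂₀-normal = solved₂-normal 3F 0F (b 3F) column₀ (generator-normal 2F) (generator-normal 0F)

  x₂₁-normal : NormalForm 7F
  x₂₁-normal = solved₂-normal 4F 1F (b 4F) column₁ (generator-normal 3F) (generator-normal 1F)

  normal-form : ∀ e → NormalForm e
  normal-form 0F = generator-normal 0F
  normal-form 1F = generator-normal 1F
  normal-form 2F = solved₂-normal 1F 0F (b 0F) row₀ (generator-normal 1F) (generator-normal 0F)
  normal-form 3F = generator-normal 2F
  normal-form 4F = generator-normal 3F
  normal-form 5F = solved₂-normal 4F 3F (b 1F) row₁ (generator-normal 3F) (generator-normal 2F)
  normal-form 6F = x₂₀-normal
  normal-form 7F = x₂₁-normal
  normal-form 8F = solved₂-normal 7F 6F (b 2F) row₂ x₂₁-normal x₂₀-normal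

K33-coordinates : Coordinates K33 4
K33-coordinates = record
  { ψ               = K33-ψ
  ; ψ-flow          = K33-ψ-flow
  ; basis           = 0F ∷ 1F ∷ 3F ∷ 4F ∷ []
  ; ψ-basis         = refl
  ; charge          = K33-charge
  ; charge-basis    = λ _ → refl
  ; charge-boundary = K33-charge-boundary
  ; basis-commute   = λ even relations → K33-relations.basis-commute even relations
  ; normal-form     = λ even relations → K33-relations.normal-form even relations
  }

-- K₅

-- Coordinates of x_e read off from the solved vertex relations vertex₀ … vertex₃ below: ψ over
-- the basis edges 0, 1, 2, 4, 5, 7 (those of the K₄ on {0,1,2,3}), and the charge as the power of J.
K5-ψ : Fin 10 → Vec Bool 6
K5-ψ 0F = unit 0F
K5-ψ 1F = unit 1F
K5-ψ 2F = unit 2F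
K5-ψ 3F = unit 2F ⊕ (unit 1F ⊕ unit 0F)
K5-ψ 4F = unit 3F
K5-ψ 5F = unit 4F
K5-ψ 6F = unit 4F ⊕ (unit 3F ⊕ unit 0F)
K5-ψ 7F = unit 5F
K5-ψ 8F = unit 5F ⊕ (unit 3F ⊕ unit 1F)
K5-ψ 9F = unit 5F ⊕ (unit 4F ⊕ unit 2F)

K5-charge : Colouring K5 → Fin 10 → Bool
K5-charge b 3F = b 0F
K5-charge b 6F = b 1F
K5-charge b 8F = b 2F
K5-charge b 9F = b 3F
K5-charge b _  = false

K5-ψ-flow : IsFlow K5 K5-ψ
K5-ψ-flow 0F = refl
K5-ψ-flow 1F = refl
K5-ψ-flow 2F = refl
K5-ψ-flow 3F = refl
K5-ψ-flow 4F = refl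

K5-charge-boundary : ∀ b → EvenParity K5 b → HasBoundary K5 (K5-charge b) b
K5-charge-boundary b _    0F = xor-identityʳ (b 0F)
K5-charge-boundary b _    1F = xor-identityʳ (b 1F)
K5-charge-boundary b _    2F = xor-identityʳ (b 2F)
K5-charge-boundary b _    3F = xor-identityʳ (b 3F)
K5-charge-boundary b even 4F = xor≡false⇒≡ (trans (parity-sum (b 0F) (b 1F) (b 2F) (b 3F) (b 4F)) even)
  where
  parity-sum : ∀ b₀ b₁ b₂ b₃ b₄ →
    (b₀ xor (b₁ xor (b₂ xor (b₃ xor false)))) xor b₄ ≡ b₀ xor (b₁ xor (b₂ xor (b₃ xor (b₄ xor false))))
  parity-sum = solve-∀ BoolRing

K5-vertex₃≡vertex₄-exponent : ∀ b → EvenParity K5 b → b 3F ≡ (b 2F xor (b 1F xor b 0F)) xor b 4F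
K5-vertex₃≡vertex₄-exponent b even = xor≡false⇒≡ (trans (parity-sum (b 0F) (b 1F) (b 2F) (b 3F) (b 4F)) even)
  where
  parity-sum : ∀ b₀ b₁ b₂ b₃ b₄ →
    b₃ xor ((b₂ xor (b₁ xor b₀)) xor b₄) ≡ b₀ xor (b₁ xor (b₂ xor (b₃ xor (b₄ xor false))))
  parity-sum = solve-∀ BoolRing

module K5-relations {b : Colouring K5} (even : EvenParity K5 b)
                    {H : Group 0ℓ 0ℓ} {x : Fin 10 → Group.Carrier H} {J : Group.Carrier H}
                    (relations : GraphRelations K5 b H x J) where
  open Group H renaming (refl to ≈-refl; sym to ≈-sym; trans to ≈-trans)
  open import Algebra.Properties.Group H using (∙-cancelˡ; ∙-cancelʳ)
  open GroupLemmas H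
  open GraphRelations relations
  open CentralInvolution J-involution J-central
  open import Relation.Binary.Reasoning.Setoid setoid

  n₀₁ n₀₂ n₀₃ n₀₄ n₁₂ n₁₃ n₁₄ n₂₃ n₂₄ n₃₄ : Carrier
  n₀₁ = x 0F
  n₀₂ = x 1F
  n₀₃ = x 2F
  n₀₄ = x 3F
  n₁₂ = x 4F
  n₁₃ = x 5F
  n₁₄ = x 6F
  n₂₃ = x 7F
  n₂₄ = x 8F
  n₃₄ = x 9F

  w₀ w₁ w₂ : Carrier
  w₀ = n₀₃ ∙ (n₀₂ ∙ n₀₁)
  w₁ = n₁₃ ∙ (n₁₂ ∙ n₀₁)
  w₂ = n₂₃ ∙ (n₁₂ ∙ n₀₂)

  vertex₀ : n₀₄ ≈ w₀ ∙ J ^ b 0F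
  vertex₀ = last-factor₄ (x-involution 0F) (x-involution 1F) (x-involution 2F) (x-vertex 0F)

  vertex₁ : n₁₄ ≈ w₁ ∙ J ^ b 1F
  vertex₁ = last-factor₄ (x-involution 0F) (x-involution 4F) (x-involution 5F) (x-vertex 1F)

  vertex₂ : n₂₄ ≈ w₂ ∙ J ^ b 2F
  vertex₂ = last-factor₄ (x-involution 1F) (x-involution 4F) (x-involution 7F) (x-vertex 2F)

  vertex₃ : n₃₄ ≈ (n₂₃ ∙ (n₁₃ ∙ n₀₃)) ∙ J ^ b 3F
  vertex₃ = last-factor₄ (x-involution 2F) (x-involution 5F) (x-involution 7F) (x-vertex 3F)

  vertex₄ : n₃₄ ≈ (n₂₄ ∙ (n₁₄ ∙ n₀₄)) ∙ J ^ b 4F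
  vertex₄ = last-factor₄ (x-involution 3F) (x-involution 6F) (x-involution 8F) (x-vertex 4F)

  -- n₃₄ solved at vertex 3 and at vertex 4, the latter expanded by the other three vertices.
  n₃₄-twice : n₂₃ ∙ (n₁₃ ∙ n₀₃) ≈ w₂ ∙ (w₁ ∙ w₀)
  n₃₄-twice = ∙-cancelʳ (J ^ b 3F) _ _ (begin
    (n₂₃ ∙ (n₁₃ ∙ n₀₃)) ∙ J ^ b 3F                                       ≈⟨ vertex₃ ⟨
    n₃₄                                                                  ≈⟨ vertex₄ ⟩
    (n₂₄ ∙ (n₁₄ ∙ n₀₄)) ∙ J ^ b 4F                                       ≈⟨ ∙-congʳ (∙-cong vertex₂ (∙-cong vertex₁ vertex₀)) ⟩
    ((w₂ ∙ J ^ b 2F) ∙ ((w₁ ∙ J ^ b 1F) ∙ (w₀ ∙ J ^ b 0F))) ∙ J ^ b 4F  ≈⟨ ∙-congʳ (∙-congˡ (interchange (b 1F) (b 0F))) ⟩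
    ((w₂ ∙ J ^ b 2F) ∙ ((w₁ ∙ w₀) ∙ J ^ (b 1F xor b 0F))) ∙ J ^ b 4F    ≈⟨ ∙-congʳ (interchange (b 2F) _) ⟩
    ((w₂ ∙ (w₁ ∙ w₀)) ∙ J ^ (b 2F xor (b 1F xor b 0F))) ∙ J ^ b 4F      ≈⟨ absorb _ (b 4F) ⟩
    (w₂ ∙ (w₁ ∙ w₀)) ∙ J ^ ((b 2F xor (b 1F xor b 0F)) xor b 4F)       ≡⟨ cong (λ p → w₂ ∙ (w₁ ∙ w₀) ∙ J ^ p) exponents ⟨
    (w₂ ∙ (w₁ ∙ w₀)) ∙ J ^ b 3F                                         ∎)
    where
    exponents = K5-vertex₃≡vertex₄-exponent b even

  n₀₂n₁₃-commute : Commute n₀₂ n₁₃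
  n₀₂n₁₃-commute = conjugate⇒commute (x-involution 1F) (∙-cancelʳ n₀₃ _ _ (∙-cancelˡ n₂₃ _ _ (begin
    n₂₃ ∙ (n₁₃ ∙ n₀₃)                                                   ≈⟨ n₃₄-twice ⟩
    w₂ ∙ (w₁ ∙ w₀)                                                      ≈⟨ solve monoid ⟩
    n₂₃ ∙ ((n₁₂ ∙ ((n₀₂ ∙ n₁₃) ∙ n₁₂)) ∙ (n₀₁ ∙ ((n₀₃ ∙ n₀₂) ∙ n₀₁)))  ≈⟨ ∙-congˡ (∙-cong conjugate₁₂ conjugate₀₁) ⟩
    n₂₃ ∙ ((n₀₂ ∙ n₁₃) ∙ (n₀₃ ∙ n₀₂))                                   ≈⟨ ∙-congˡ (∙-congˡ (x-commute incident₁ incident₁)) ⟩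
    n₂₃ ∙ ((n₀₂ ∙ n₁₃) ∙ (n₀₂ ∙ n₀₃))                                   ≈⟨ solve monoid ⟩
    n₂₃ ∙ ((n₀₂ ∙ (n₁₃ ∙ n₀₂)) ∙ n₀₃)                                   ∎)))
    where
    conjugate₁₂ : n₁₂ ∙ ((n₀₂ ∙ n₁₃) ∙ n₁₂) ≈ n₀₂ ∙ n₁₃
    conjugate₁₂ = involution-conjugate (x-involution 4F)
      (commute-∙ (x-commute incident₂ incident₂) (x-commute incident₁ incident₁))
    conjugate₀₁ : n₀₁ ∙ ((n₀₃ ∙ n₀₂) ∙ n₀₁) ≈ n₀₃ ∙ n₀₂
    conjugate₀₁ = involution-conjugate (x-involution 0F)
      (commute-∙ (x-commute incident₁ incident₁) (x-commute incident₁ incident₁))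

  n₀₁n₂₃-commute : Commute n₀₁ n₂₃
  n₀₁n₂₃-commute = cross-commute (x-commute incident₂ incident₁) (x-commute incident₂ incident₁)
    n₀₂n₁₃-commute n₀₄n₃₄-commute
    where
    -- n₀₄ and n₃₄ commute at vertex 4; modulo J they share the factor n₀₃, which commutes with the rest.
    n₀₄n₃₄-commute : Commute (n₀₂ ∙ n₀₁) (n₂₃ ∙ n₁₃)
    n₀₄n₃₄-commute = commute-conjugate (x-involution 2F)
      (commute-∙ (x-commute incident₁ incident₁) (x-commute incident₁ incident₁))
      (commute-∙ (x-commute incident₂ incident₂) (x-commute incident₂ incident₂))
      (commute-resp ≈-refl (≈-sym (assoc _ _ _))
        (commute-modulo (commute-resp vertex₀ vertex₃ (x-commute incident₂ incident₂))))

  n₀₃n₁₂-commute : Commute n₀₃ n₁₂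
  n₀₃n₁₂-commute = cross-commute (x-commute incident₂ incident₁) (x-commute incident₂ incident₂)
    n₀₁n₂₃-commute n₀₄n₂₄-commute
    where
    reorder₀ : w₀ ≈ n₀₂ ∙ (n₀₁ ∙ n₀₃)
    reorder₀ = ≈-trans (commute-∙ (x-commute incident₁ incident₁) (x-commute incident₁ incident₁)) (assoc _ _ _)
    reorder₂ : w₂ ≈ (n₁₂ ∙ n₂₃) ∙ n₀₂
    reorder₂ = ≈-trans (≈-sym (assoc _ _ _)) (∙-congʳ (x-commute incident₁ incident₂))
    n₀₄n₂₄-commute : Commute (n₀₁ ∙ n₀₃) (n₁₂ ∙ n₂₃)
    n₀₄n₂₄-commute = commute-conjugate (x-involution 1F)
      (commute-∙ (x-commute incident₁ incident₁) (x-commute incident₁ incident₁))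
      (commute-∙ (x-commute incident₂ incident₂) (x-commute incident₂ incident₁))
      (commute-resp reorder₀ reorder₂
        (commute-modulo (commute-resp vertex₀ vertex₂ (x-commute incident₂ incident₂))))

  basis : Vec Carrier 6
  basis = n₀₁ ∷ n₀₂ ∷ n₀₃ ∷ n₁₂ ∷ n₁₃ ∷ n₂₃ ∷ []

  basis-commute : CommutingInvolutions basis
  basis-commute =
    x-involution 0F ∷ x-involution 1F ∷ x-involution 2F ∷ x-involution 4F ∷ x-involution 5F ∷ x-involution 7F ∷ [] ,
    (x-commute incident₁ incident₁ ∷ x-commute incident₁ incident₁ ∷ x-commute incident₂ incident₁ ∷
     x-commute incident₂ incident₁ ∷ n₀₁n₂₃-commute ∷ []) ∷
    (x-commute incident₁ incident₁ ∷ x-commute incident₂ incident₂ ∷ n₀₂n₁₃-commute ∷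
     x-commute incident₂ incident₁ ∷ []) ∷
    (n₀₃n₁₂-commute ∷ x-commute incident₂ incident₂ ∷ x-commute incident₂ incident₂ ∷ []) ∷
    (x-commute incident₁ incident₁ ∷ x-commute incident₂ incident₁ ∷ []) ∷
    (x-commute incident₂ incident₂ ∷ []) ∷
    [] ∷ []

  J∷basis-commute : CommutingInvolutions (J ∷ basis)
  J∷basis-commute = central-involution-∷ J-involution J-central basis-commute

  open NormalForms x J∷basis-commute (K5-charge b) K5-ψ

  normal-form : ∀ e → NormalForm e
  normal-form 0F = generator-normal 0F
  normal-form 1F = generator-normal 1F
  normal-form 2F = generator-normal 2F
  normal-form 3F = solved₃-normal 2F 1F 0F (b 0F) vertex₀ (generator-normal 2F) (generator-normal 1F) (generator-normal 0F)
  normal-form 4F = generator-normal 3F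
  normal-form 5F = generator-normal 4F
  normal-form 6F = solved₃-normal 5F 4F 0F (b 1F) vertex₁ (generator-normal 4F) (generator-normal 3F) (generator-normal 0F)
  normal-form 7F = generator-normal 5F
  normal-form 8F = solved₃-normal 7F 4F 1F (b 2F) vertex₂ (generator-normal 5F) (generator-normal 3F) (generator-normal 1F)
  normal-form 9F = solved₃-normal 7F 5F 2F (b 3F) vertex₃ (generator-normal 5F) (generator-normal 4F) (generator-normal 2F)

K5-coordinates : Coordinates K5 6
K5-coordinates = record
  { ψ               = K5-ψ
  ; ψ-flow          = K5-ψ-flow
  ; basis           = 0F ∷ 1F ∷ 2F ∷ 4F ∷ 5F ∷ 7F ∷ []
  ; ψ-basis         = refl
  ; charge          = K5-charge
  ; charge-basis    = λ _ → refl
  ; charge-boundary = K5-charge-boundary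
  ; basis-commute   = λ even relations → K5-relations.basis-commute even relations
  ; normal-form     = λ even relations → K5-relations.normal-form even relations
  }

corollary4p6 : ((Γ K33 ≅ Z2^ 4) × (∀ (b : Colouring K33) → EvenParity K33 b → Γb K33 b ≅ Z2^ 5))
    × ((Γ K5 ≅ Z2^ 6) × (∀ (b : Colouring K5) → EvenParity K5 b → Γb K5 b ≅ Z2^ 7))
corollary4p6 = (Γ≅Z2^ K33-coordinates , Γb≅Z2^ K33-coordinates) , (Γ≅Z2^ K5-coordinates , Γb≅Z2^ K5-coordinates)
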